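{- The rna number of a path $P_n$ with $n\ge 2$ vertices is $1$, and the rna number of a cycle $C_n$ ($n\ge 3$) is $2$. Moreover, for $G$ a path of order at least $2$ or a cycle, $\sigma^-(G)=\sigma^+(G)$ if and only if $G$ is $P_3$ or $C_4$.
   Context: For a graph $G$ with $N$ vertices and a bijection $f:V(G)\to\{1,\dots,N\}$, call an edge $uv$ negative under $f$ if $f(u)$ and $f(v)$ have opposite parity, and positive otherwise. The rna number $\sigma^-(G)$ is the minimum, over all such bijections $f$, of the number of negative edges under $f$; the adhika number $\sigma^+(G)$ is the maximum, over all such bijections, of the number of positive edges under $f$. -}

module Defs where

open import Data.Nat using (ℕ; zero; suc; _+_; _∸_; _≤_; _%_)
open import Data.Nat.Properties using (_≟_)
open import Data.Fin using (Fin; zero; suc; toℕ; inject₁; fromℕ)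
open import Data.List using (List; []; _∷_; map; length; _++_; [_]; allFin)
open import Data.Product using (_×_; _,_; ∃-syntax)
open import Function.Bundles using (_⤖_; Bijection)
open import Relation.Nullary using (yes; no)
open import Relation.Binary.PropositionalEquality using (_≡_)

Graph : ℕ → Set
Graph n = List (Fin n × Fin n)

pathEdges : (n : ℕ) → Graph n
pathEdges zero    = []
pathEdges (suc m) = map (λ i → inject₁ i , suc i) (allFin m)

-- The cycle C_n (meaningful for n ≥ 3): path edges plus the edge {n-1, 0}.
-- For n < 3 this is just the path (never used).
cycleEdges : (n : ℕ) → Graph n
cycleEdges (suc (suc (suc k))) = pathEdges (3 + k) ++ [ (fromℕ (2 + k) , zero) ]
cycleEdges n = pathEdges n

-- A labelling: bijection f : V(G) → {1,…,N}, encoded as a bijection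
-- π : Fin N ⤖ Fin N with f(v) = toℕ (π v) + 1.
Labelling : ℕ → Set
Labelling n = Fin n ⤖ Fin n

label : ∀ {n} → Labelling n → Fin n → ℕ
label f v = suc (toℕ (Bijection.to f v))

negCount : ∀ {n} → Labelling n → Graph n → ℕ
negCount f [] = 0
negCount f ((u , v) ∷ es) with label f u % 2 ≟ label f v % 2
... | yes _ = negCount f es
... | no  _ = suc (negCount f es)

posCount : ∀ {n} → Labelling n → Graph n → ℕ
posCount f [] = 0
posCount f ((u , v) ∷ es) with label f u % 2 ≟ label f v % 2
... | yes _ = suc (posCount f es)
... | no  _ = posCount f es

-- σ⁻(G) = k : k is the minimum over labellings of the number of negative edges
IsRna : ∀ {n} → Graph n → ℕ → Set
IsRna {n} G k = (∃[ f ] negCount f G ≡ k) × (∀ (f : Labelling n) → k ≤ negCount f G)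

-- σ⁺(G) = k : k is the maximum over labellings of the number of positive edges
IsAdhika : ∀ {n} → Graph n → ℕ → Set
IsAdhika {n} G k = (∃[ f ] posCount f G ≡ k) × (∀ (f : Labelling n) → posCount f G ≤ k)

-- Under any labelling of at least two vertices both parities occur (at the labels 1 and 2),
-- so walking along a path the parity changes at least once; walking around a cycle it
-- returns to its start, so it cannot change exactly once and changes at least twice.
-- Both bounds are attained by placing the labels 1, 2, 3, … alternately at the two ends
-- of a growing path, …5 3 1 2 4 6…, which puts all labels of one parity before all labels
-- of the other. Positive and negative edges partition the edges, hence σ⁺ = |E| − σ⁻,
-- which is n − 2 both for Pₙ and for Cₙ; it equals σ⁻ only for P₃ and C₄.
module Submission where

open import Defs
open import Data.Nat using (ℕ; zero; suc; _+_; _≤_; _%_; z≤n; s≤s)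
open import Data.Nat.Properties
  using (_≟_; +-assoc; +-comm; +-suc; +-identityʳ; +-cancelˡ-≡; +-cancelʳ-≡; +-cancelʳ-≤;
         +-monoʳ-≤; ≤-antisym; ≤-trans; ≤-reflexive; n≢0⇒n>0; m+n≡0⇒m≡0; m+n≡0⇒n≡0;
         suc-injective)
open import Data.Nat.DivMod using ([m+n]%n≡m%n)
open import Data.Fin using (Fin; zero; suc; toℕ; inject₁; fromℕ; punchIn)
import Data.Fin as Fin
open import Data.Fin.Properties using (toℕ-inject₁; toℕ-fromℕ)
open import Data.Fin.Permutation using (Permutation′; insert; _⟨$⟩ʳ_; insert-punchIn)
import Data.Fin.Permutation as Permutation
open import Data.List using ([]; _∷_; _++_; [_]; length; tabulate)
open import Data.List.Properties using (map-tabulate; length-tabulate; length-++)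
open import Data.Product using (_×_; _,_; proj₁; proj₂; ∃-syntax)
open import Data.Empty using (⊥-elim)
open import Function using (_∘_; id)
open import Function.Bundles using (Bijection; _⇔_; mk⇔)
open import Function.Construct.Composition using (_⇔-∘_)
open import Function.Properties.Inverse using (↔⇒⤖)
open import Relation.Nullary using (yes; no)
open import Relation.Binary.PropositionalEquality
  using (_≡_; _≢_; refl; sym; trans; cong; cong₂; subst; module ≡-Reasoning)

differ : ℕ → ℕ → ℕ
differ a b with a ≟ b
... | yes _ = 0
... | no  _ = 1

differ-≡ : ∀ {a b} → a ≡ b → differ a b ≡ 0
differ-≡ {a} {b} a≡b with a ≟ b
... | yes _   = refl
... | no  a≢b = ⊥-elim (a≢b a≡b)

differ-≢ : ∀ {a b} → a ≢ b → differ a b ≡ 1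
differ-≢ {a} {b} a≢b with a ≟ b
... | yes a≡b = ⊥-elim (a≢b a≡b)
... | no  _   = refl

differ≡0⇒≡ : ∀ a b → differ a b ≡ 0 → a ≡ b
differ≡0⇒≡ a b _ with a ≟ b
differ≡0⇒≡ a b _  | yes a≡b = a≡b
differ≡0⇒≡ a b () | no  _

changes : ∀ m → (Fin (suc m) → ℕ) → ℕ
changes zero    q = 0
changes (suc m) q = differ (q zero) (q (suc zero)) + changes m (q ∘ suc)

labelParity : ∀ {n} → Fin n → ℕ
labelParity x = suc (toℕ x) % 2

parity : ∀ {n} → Labelling n → Fin n → ℕ
parity f = labelParity ∘ Bijection.to f

module _ {n} (f : Labelling n) where

  negCount-∷ : ∀ u v es →
    negCount f ((u , v) ∷ es) ≡ differ (parity f u) (parity f v) + negCount f es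
  negCount-∷ u v es with parity f u ≟ parity f v
  ... | yes _ = refl
  ... | no  _ = refl

  negCount-++ : ∀ es es′ → negCount f (es ++ es′) ≡ negCount f es + negCount f es′
  negCount-++ []             es′ = refl
  negCount-++ ((u , v) ∷ es) es′ = begin
    negCount f ((u , v) ∷ es ++ es′)       ≡⟨ negCount-∷ u v (es ++ es′) ⟩
    d + negCount f (es ++ es′)             ≡⟨ cong (d +_) (negCount-++ es es′) ⟩
    d + (negCount f es + negCount f es′)   ≡⟨ +-assoc d _ _ ⟨
    (d + negCount f es) + negCount f es′   ≡⟨ cong (_+ negCount f es′) (negCount-∷ u v es) ⟨
    negCount f ((u , v) ∷ es) + negCount f es′ ∎
    where
    open ≡-Reasoning
    d = differ (parity f u) (parity f v)

  negCount-walk : ∀ m (w : Fin (suc m) → Fin n) →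
    negCount f (tabulate (λ i → w (inject₁ i) , w (suc i))) ≡ changes m (parity f ∘ w)
  negCount-walk zero    w = refl
  negCount-walk (suc m) w =
    trans (negCount-∷ (w zero) (w (suc zero)) _)
          (cong (differ (parity f (w zero)) (parity f (w (suc zero))) +_) (negCount-walk m (w ∘ suc)))

  posCount+negCount≡length : ∀ G → posCount f G + negCount f G ≡ length G
  posCount+negCount≡length []             = refl
  posCount+negCount≡length ((u , v) ∷ es) with parity f u ≟ parity f v
  ... | yes _ = cong suc (posCount+negCount≡length es)
  ... | no  _ = trans (+-suc _ _) (cong suc (posCount+negCount≡length es))

changes-cong : ∀ m {q q′ : Fin (suc m) → ℕ} → (∀ i → q i ≡ q′ i) → changes m q ≡ changes m q′
changes-cong zero    q≗q′ = refl
changes-cong (suc m) q≗q′ =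
  cong₂ _+_ (cong₂ differ (q≗q′ zero) (q≗q′ (suc zero))) (changes-cong m (q≗q′ ∘ suc))

changes-snoc : ∀ m (q : Fin (2 + m) → ℕ) →
  changes (suc m) q ≡ changes m (q ∘ inject₁) + differ (q (inject₁ (fromℕ m))) (q (fromℕ (suc m)))
changes-snoc zero    q = +-identityʳ _
changes-snoc (suc m) q = trans (cong (d +_) (changes-snoc m (q ∘ suc))) (sym (+-assoc d _ _))
  where d = differ (q zero) (q (suc zero))

changes≡0⇒constant : ∀ m (q : Fin (suc m) → ℕ) → changes m q ≡ 0 → ∀ i → q i ≡ q zero
changes≡0⇒constant m       q _  zero    = refl
changes≡0⇒constant (suc m) q c0 (suc i) =
  trans (changes≡0⇒constant m (q ∘ suc) (m+n≡0⇒n≡0 (differ _ _) c0) i)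
        (sym (differ≡0⇒≡ _ _ (m+n≡0⇒m≡0 _ c0)))

-- One change splits the sequence into two constant blocks with different values.
changes≡1⇒ends-differ : ∀ m (q : Fin (suc m) → ℕ) → changes m q ≡ 1 → q (fromℕ m) ≢ q zero
changes≡1⇒ends-differ (suc m) q c1 with q zero ≟ q (suc zero)
... | yes q₀≡q₁ = λ e → changes≡1⇒ends-differ m (q ∘ suc) c1 (trans e q₀≡q₁)
... | no  q₀≢q₁ = λ e →
  q₀≢q₁ (sym (trans (sym (changes≡0⇒constant m (q ∘ suc) (suc-injective c1) (fromℕ m))) e))

2≤changes+closing : ∀ m (q : Fin (suc m) → ℕ) → changes m q ≢ 0 →
  2 ≤ changes m q + differ (q (fromℕ m)) (q zero)
2≤changes+closing m q c≢0 with changes m q in c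
... | zero        = ⊥-elim (c≢0 refl)
... | suc (suc _) = s≤s (s≤s z≤n)
... | suc zero    rewrite differ-≢ (changes≡1⇒ends-differ m q c) = s≤s (s≤s z≤n)

negCount-path : ∀ m (f : Labelling (suc m)) → negCount f (pathEdges (suc m)) ≡ changes m (parity f)
negCount-path m f =
  trans (cong (negCount f) (map-tabulate id (λ i → inject₁ i , suc i))) (negCount-walk f m id)

negCount-cycle : ∀ k (f : Labelling (3 + k)) →
  negCount f (cycleEdges (3 + k))
    ≡ changes (2 + k) (parity f) + differ (parity f (fromℕ (2 + k))) (parity f zero)
negCount-cycle k f = begin
  negCount f (pathEdges (3 + k) ++ [ (fromℕ (2 + k) , zero) ])
    ≡⟨ negCount-++ f (pathEdges (3 + k)) _ ⟩
  negCount f (pathEdges (3 + k)) + negCount f [ (fromℕ (2 + k) , zero) ]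
    ≡⟨ cong₂ _+_ (negCount-path (2 + k) f) (negCount-∷ f (fromℕ (2 + k)) zero []) ⟩
  changes (2 + k) (parity f) + (closing + 0)
    ≡⟨ cong (changes (2 + k) (parity f) +_) (+-identityʳ closing) ⟩
  changes (2 + k) (parity f) + closing ∎
  where
  open ≡-Reasoning
  closing = differ (parity f (fromℕ (2 + k))) (parity f zero)

changes≢0 : ∀ m (f : Labelling (2 + m)) → changes (suc m) (parity f) ≢ 0
changes≢0 m f c0 = odd≢even (begin
  1                                ≡⟨ parity-of zero ⟨
  parity f (vertex zero)           ≡⟨ constant (vertex zero) ⟩
  parity f zero                    ≡⟨ constant (vertex (suc zero)) ⟨
  parity f (vertex (suc zero))     ≡⟨ parity-of (suc zero) ⟩
  0                                ∎)
  where
  open ≡-Reasoning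
  constant = changes≡0⇒constant (suc m) (parity f) c0
  vertex : Fin (2 + m) → Fin (2 + m)
  vertex x = proj₁ (Bijection.surjective f x)
  parity-of : ∀ x → parity f (vertex x) ≡ labelParity x
  parity-of x = cong labelParity (proj₂ (Bijection.surjective f x) refl)
  odd≢even : 1 ≢ 0
  odd≢even ()

labelParity-inject₁ : ∀ {n} (x : Fin n) → labelParity (inject₁ x) ≡ labelParity x
labelParity-inject₁ x = cong (λ k → suc k % 2) (toℕ-inject₁ x)

labelParity-fromℕ : ∀ n → labelParity (fromℕ n) ≡ suc n % 2
labelParity-fromℕ n = cong (λ k → suc k % 2) (toℕ-fromℕ n)

2+n%2≡n%2 : ∀ n → (2 + n) % 2 ≡ n % 2
2+n%2≡n%2 n = trans (cong (_% 2) (+-comm 2 n)) ([m+n]%n≡m%n n 2)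

punchIn-fromℕ : ∀ n (k : Fin n) → punchIn (fromℕ n) k ≡ inject₁ k
punchIn-fromℕ (suc n) zero    = refl
punchIn-fromℕ (suc n) (suc k) = cong suc (punchIn-fromℕ n k)

insert-self : ∀ {n} (i j : Fin (suc n)) (π : Permutation′ n) → insert i j π ⟨$⟩ʳ i ≡ j
insert-self i j π with i Fin.≟ i
... | yes _   = refl
... | no  i≢i = ⊥-elim (i≢i refl)

module _ {n} (π : Permutation′ n) where

  prepend append : Permutation′ (suc n)
  prepend = insert zero (fromℕ n) π
  append  = insert (fromℕ n) (fromℕ n) π

  prepend-suc : ∀ k → prepend ⟨$⟩ʳ suc k ≡ inject₁ (π ⟨$⟩ʳ k)
  prepend-suc k = trans (insert-punchIn zero (fromℕ n) π k) (punchIn-fromℕ n (π ⟨$⟩ʳ k))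

  append-inject₁ : ∀ k → append ⟨$⟩ʳ inject₁ k ≡ inject₁ (π ⟨$⟩ʳ k)
  append-inject₁ k = begin
    append ⟨$⟩ʳ inject₁ k                  ≡⟨ cong (append ⟨$⟩ʳ_) (punchIn-fromℕ n k) ⟨
    append ⟨$⟩ʳ punchIn (fromℕ n) k        ≡⟨ insert-punchIn (fromℕ n) (fromℕ n) π k ⟩
    punchIn (fromℕ n) (π ⟨$⟩ʳ k)           ≡⟨ punchIn-fromℕ n (π ⟨$⟩ʳ k) ⟩
    inject₁ (π ⟨$⟩ʳ k)                     ∎
    where open ≡-Reasoning

  parity-prepend-suc : ∀ k → parity (↔⇒⤖ prepend) (suc k) ≡ parity (↔⇒⤖ π) k
  parity-prepend-suc k = trans (cong labelParity (prepend-suc k)) (labelParity-inject₁ (π ⟨$⟩ʳ k))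

  parity-append-inject₁ : ∀ k → parity (↔⇒⤖ append) (inject₁ k) ≡ parity (↔⇒⤖ π) k
  parity-append-inject₁ k = trans (cong labelParity (append-inject₁ k)) (labelParity-inject₁ (π ⟨$⟩ʳ k))

  parity-prepend-zero : parity (↔⇒⤖ prepend) zero ≡ suc n % 2
  parity-prepend-zero = trans (cong labelParity (insert-self zero (fromℕ n) π)) (labelParity-fromℕ n)

  parity-append-fromℕ : parity (↔⇒⤖ append) (fromℕ n) ≡ suc n % 2
  parity-append-fromℕ = trans (cong labelParity (insert-self (fromℕ n) (fromℕ n) π)) (labelParity-fromℕ n)

module _ {m} (π : Permutation′ (suc m)) where

  changes-prepend : changes (suc m) (parity (↔⇒⤖ (prepend π)))
                  ≡ differ ((2 + m) % 2) (parity (↔⇒⤖ π) zero) + changes m (parity (↔⇒⤖ π))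
  changes-prepend = cong₂ _+_ (cong₂ differ (parity-prepend-zero π) (parity-prepend-suc π zero))
                              (changes-cong m (parity-prepend-suc π))

  changes-append : changes (suc m) (parity (↔⇒⤖ (append π)))
                 ≡ changes m (parity (↔⇒⤖ π)) + differ (parity (↔⇒⤖ π) (fromℕ m)) ((2 + m) % 2)
  changes-append = trans (changes-snoc m (parity (↔⇒⤖ (append π))))
    (cong₂ _+_ (changes-cong m (parity-append-inject₁ π))
               (cong₂ differ (parity-append-inject₁ π (fromℕ m)) (parity-append-fromℕ π)))

outward : ∀ n → Permutation′ n
outward zero          = Permutation.id
outward (suc zero)    = Permutation.id
outward (suc (suc n)) = append (prepend (outward n))

outward-first : ∀ m → parity (↔⇒⤖ (outward (2 + m))) zero ≡ suc m % 2
outward-first m = trans (parity-append-inject₁ (prepend (outward m)) zero) (parity-prepend-zero (outward m))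

outward-last : ∀ m → parity (↔⇒⤖ (outward (2 + m))) (fromℕ (suc m)) ≡ (2 + m) % 2
outward-last m = parity-append-fromℕ (prepend (outward m))

outward-changes : ∀ m → changes (suc m) (parity (↔⇒⤖ (outward (2 + m)))) ≡ 1
outward-changes zero          = refl
outward-changes (suc zero)    = refl
outward-changes (suc (suc m)) = begin
  changes (3 + m) (parity (↔⇒⤖ (append ρ)))
    ≡⟨ changes-append ρ ⟩
  changes (2 + m) (parity (↔⇒⤖ ρ)) + differ (parity (↔⇒⤖ ρ) (fromℕ (2 + m))) ((4 + m) % 2)
    ≡⟨ cong₂ _+_ (changes-prepend π) (cong (λ x → differ x ((4 + m) % 2)) ρ-last) ⟩
  (differ ((3 + m) % 2) (parity (↔⇒⤖ π) zero) + changes (suc m) (parity (↔⇒⤖ π)))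
    + differ ((2 + m) % 2) ((4 + m) % 2)
    ≡⟨ cong₂ _+_ (cong₂ _+_ front-unchanged (outward-changes m)) back-unchanged ⟩
  1 ∎
  where
  open ≡-Reasoning
  π = outward (2 + m)
  ρ = prepend π
  ρ-last : parity (↔⇒⤖ ρ) (fromℕ (2 + m)) ≡ (2 + m) % 2
  ρ-last = trans (parity-prepend-suc π (fromℕ (suc m))) (outward-last m)
  front-unchanged : differ ((3 + m) % 2) (parity (↔⇒⤖ π) zero) ≡ 0
  front-unchanged = differ-≡ (trans (2+n%2≡n%2 (suc m)) (sym (outward-first m)))
  back-unchanged : differ ((2 + m) % 2) ((4 + m) % 2) ≡ 0
  back-unchanged = differ-≡ (sym (2+n%2≡n%2 (2 + m)))

pathRna : ∀ m → IsRna (pathEdges (2 + m)) 1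
pathRna m = (f , trans (negCount-path (suc m) f) (outward-changes m))
          , λ g → subst (1 ≤_) (sym (negCount-path (suc m) g)) (n≢0⇒n>0 (changes≢0 m g))
  where f = ↔⇒⤖ (outward (2 + m))

cycleRna : ∀ k → IsRna (cycleEdges (3 + k)) 2
cycleRna k = (f , trans (negCount-cycle k f) (cong₂ _+_ one-change closing-differs))
           , λ g → subst (2 ≤_) (sym (negCount-cycle k g))
                         (2≤changes+closing (2 + k) (parity g) (changes≢0 (suc k) g))
  where
  f = ↔⇒⤖ (outward (3 + k))
  one-change = outward-changes (suc k)
  closing-differs = differ-≢ (changes≡1⇒ends-differ (2 + k) (parity f) one-change)

module _ {n} {G : Graph n} where

  rna-unique : ∀ {r s} → IsRna G r → IsRna G s → r ≡ s
  rna-unique ((f , fr) , r≤) ((g , gs) , s≤) = ≤-antisym (subst (_ ≤_) gs (r≤ g)) (subst (_ ≤_) fr (s≤ f))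

  adhika-unique : ∀ {r s} → IsAdhika G r → IsAdhika G s → r ≡ s
  adhika-unique ((f , fr) , ≤r) ((g , gs) , ≤s) = ≤-antisym (subst (_≤ _) fr (≤s f)) (subst (_≤ _) gs (≤r g))

  rna⇒adhika : ∀ {r a} → IsRna G r → a + r ≡ length G → IsAdhika G a
  rna⇒adhika {r} {a} ((f , fr) , r≤) a+r≡∣G∣ =
      (f , +-cancelʳ-≡ r _ _ (trans (cong (posCount f G +_) (sym fr)) (partition f)))
    , λ g → +-cancelʳ-≤ r _ _ (≤-trans (+-monoʳ-≤ (posCount g G) (r≤ g)) (≤-reflexive (partition g)))
    where
    partition : ∀ g → posCount g G + negCount g G ≡ a + r
    partition g = trans (posCount+negCount≡length g G) (sym a+r≡∣G∣)

  adhika-from-rna : ∀ {r a} {P : Set} → IsRna G r → a + r ≡ length G → (r ≡ a ⇔ P) →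
    ∃[ a ] IsAdhika G a × (∀ r′ a′ → IsRna G r′ → IsAdhika G a′ → (r′ ≡ a′ ⇔ P))
  adhika-from-rna {r} {a} rna a+r≡∣G∣ r≡a⇔P = a , adhika , λ r′ a′ rna′ adhika′ →
    r≡a⇔P ⇔-∘ mk⇔ (λ r′≡a′ → trans (rna-unique rna rna′) (trans r′≡a′ (adhika-unique adhika′ adhika)))
                  (λ r≡a → trans (rna-unique rna′ rna) (trans r≡a (adhika-unique adhika adhika′)))
    where adhika = rna⇒adhika rna a+r≡∣G∣

length-path : ∀ m → length (pathEdges (suc m)) ≡ m
length-path m = trans (cong length (map-tabulate {n = m} id (λ i → inject₁ i , suc i)))
                      (length-tabulate (λ i → inject₁ i , suc i))

length-cycle : ∀ k → length (cycleEdges (3 + k)) ≡ 3 + k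
length-cycle k = trans (length-++ (pathEdges (3 + k)))
                       (trans (cong (_+ 1) (length-path (2 + k))) (+-comm (2 + k) 1))

≡⇔+-sym : ∀ k {a b} → (a ≡ b) ⇔ (k + b ≡ k + a)
≡⇔+-sym k = mk⇔ (λ a≡b → cong (k +_) (sym a≡b)) (λ e → sym (+-cancelˡ-≡ k _ _ e))

from-offset : ∀ k {P : ℕ → Set} → (∀ m → P (k + m)) → ∀ n → k ≤ n → P n
from-offset zero        h n       _         = h n
from-offset (suc k) {P} h (suc n) (s≤s k≤n) = from-offset k {P ∘ suc} h n k≤n

theorem11 :
    (∀ (n : ℕ) → 2 ≤ n → IsRna (pathEdges n) 1)
    × (∀ (n : ℕ) → 3 ≤ n → IsRna (cycleEdges n) 2)
    × (∀ (n : ℕ) → 2 ≤ n → ∃[ a ] IsAdhika (pathEdges n) a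
        × (∀ r a → IsRna (pathEdges n) r → IsAdhika (pathEdges n) a → (r ≡ a ⇔ n ≡ 3)))
    × (∀ (n : ℕ) → 3 ≤ n → ∃[ a ] IsAdhika (cycleEdges n) a
        × (∀ r a → IsRna (cycleEdges n) r → IsAdhika (cycleEdges n) a → (r ≡ a ⇔ n ≡ 4)))
theorem11 = from-offset 2 pathRna
          , from-offset 3 cycleRna
          , from-offset 2 (λ m → adhika-from-rna (pathRna m) (path-size m) (≡⇔+-sym 2))
          , from-offset 3 (λ k → adhika-from-rna (cycleRna k) (cycle-size k) (≡⇔+-sym 2))
  where
  path-size : ∀ m → m + 1 ≡ length (pathEdges (2 + m))
  path-size m = trans (+-comm m 1) (sym (length-path (suc m)))
  cycle-size : ∀ k → suc k + 2 ≡ length (cycleEdges (3 + k))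
  cycle-size k = trans (+-comm (suc k) 2) (sym (length-cycle k))
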